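{- For every odd prime power $q\ge3$ and every integer $t\ge2$, $$W(q^{2^t}-1)<2q^{\frac{2^t}{t-1}}.$$
   Context: $W(m)$ denotes the number of square-free positive divisors of the positive integer $m$. -}

module Defs where

open import Data.Nat.Base
open import Data.Nat.Properties using (allUpTo?; ≤-trans; m≤m*n)
open import Data.Nat.Divisibility using (_∣_; _∣?_; ∣⇒≤; ∣-trans; divides)
open import Data.Nat.Primality using (Prime; prime?; prime[2])
open import Data.List.Base using (List; filter; length; upTo; map)
open import Data.Product.Base using (Σ; ∃-syntax; _×_; _,_)
open import Relation.Nullary using (Dec; yes; no; ¬_; ¬?)
open import Relation.Nullary.Decidable using (_→-dec_; _×-dec_)
open import Relation.Binary.PropositionalEquality using (_≡_; refl)

SquareFree : ℕ → Set
SquareFree d = ∀ p → Prime p → ¬ (p * p ∣ d)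

squareFree? : (d : ℕ) → Dec (SquareFree d)
squareFree? zero = no (λ sf → sf 2 prime[2] (divides 0 refl))
squareFree? d@(suc _) with allUpTo? (λ p → prime? p →-dec ¬? (p * p ∣? d)) (suc d)
... | yes h = yes (λ p pp pp∣d → h (s≤s (≤-trans′ p pp pp∣d)) pp pp∣d)
  where
  ≤-trans′ : ∀ p → Prime p → p * p ∣ d → p ≤ d
  ≤-trans′ p@(suc _) _ pp∣d =
    ≤-trans (m≤m*n p p) (∣⇒≤ pp∣d)
... | no ¬h = no (λ sf → ¬h (λ {p} _ pp → sf p pp))

W : ℕ → ℕ
W m = length (filter (λ d → (d ∣? m) ×-dec squareFree? d) (map suc (upTo m)))

PrimePower : ℕ → Set
PrimePower q = ∃[ p ] ∃[ k ] (Prime p × 1 ≤ k × q ≡ p ^ k)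

module Submission where

-- For odd q ≥ 3 let Z j = q ^ 2^(j+1), N j = Z j - 1, F j = Z j + 1; then
-- N (j + 1) = N j * F j and q ^ 2^t - 1 = N (t - 1).  If the prime divisors
-- of m lie in a list of s primes, m has at most 2^s square-free divisors,
-- so it suffices to count primes.  N 0 < q² has at most 2 log₂ q of them.
-- A prime new in F j is odd and q has order 2^(j+2) modulo it, so by
-- Fermat it is ≡ 1 (mod 2^(j+2)); all such primes but possibly 2^(j+2) + 1
-- are ≥ 2^(j+3), bounding their number by 2^(j+1) log₂ q / (j + 3).
-- Summing gives (t - 1) * #primes(N (t - 1)) ≤ 2^t log₂ q, i.e. even
-- W (q ^ 2^t - 1) ^ (t - 1) ≤ q ^ 2^t.

open import Defs
open import Algebra.Properties.CommutativeSemigroup using (x∙yz≈y∙xz)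
open import Data.Nat.Base
open import Data.Nat.Properties
open import Data.Nat.Divisibility
open import Data.Nat.DivMod using (_%_; _/_; %-distribˡ-*; [m+kn]%n≡m%n; m<n⇒m%n≡m; %-pred-≡0; m/n*n≡m)
open import Data.Nat.Primality using (Prime; prime?; prime[2]; euclidsLemma; prime⇒nonZero; prime⇒nonTrivial; productOfPrimes≢0)
open import Data.Nat.Primality.Factorisation using (factorise; factorisationHasAllPrimeFactors)
open import Data.Nat.Combinatorics using (_C_; nCk≡n!/k![n-k]!; k![n∸k]!∣n!; k>n⇒nCk≡0; nCn≡1; nCk+nC[k+1]≡[n+1]C[k+1])
open import Data.Nat.ListAction using (product)
open import Data.Nat.Tactic.RingSolver using (solve-∀)
open import Data.List.Base using (List; []; _∷_; _++_; [_]; map; filter; length; upTo)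
open import Data.List.Properties using (length-++; length-map)
open import Data.List.Membership.Propositional using (_∈_; _∉_)
open import Data.List.Membership.Propositional.Properties using (∈-∃++; ∈-++⁺ˡ; ∈-++⁺ʳ; ∈-++⁻; ∈-map⁺; ∈-map⁻; ∈-filter⁺; ∈-filter⁻; ∈-upTo⁺)
open import Data.List.Relation.Unary.Any using (here; there)
open import Data.List.Relation.Unary.All as All using (All; []; _∷_)
open import Data.List.Relation.Unary.Unique.Propositional using (Unique)
open import Data.List.Relation.Unary.AllPairs using ([]; _∷_)
import Data.List.Relation.Unary.Unique.Propositional.Properties as Unique
open import Data.Product.Base using (∃-syntax; _×_; _,_; proj₁; proj₂)
open import Data.Sum.Base using (_⊎_; inj₁; inj₂)
open import Data.Empty using (⊥-elim)
open import Relation.Nullary using (¬_; ¬?; yes; no)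
open import Relation.Nullary.Decidable using (_×-dec_)
open import Relation.Binary.PropositionalEquality using (_≡_; _≢_; refl; sym; trans; cong; cong₂; subst; subst₂; module ≡-Reasoning)

unique⊆⇒length≤ : ∀ {xs ys : List ℕ} → Unique xs → (∀ {x} → x ∈ xs → x ∈ ys) →
                  length xs ≤ length ys
unique⊆⇒length≤ {[]} _ _ = z≤n
unique⊆⇒length≤ {x ∷ xs} {ys} (x∉xs ∷ uxs) xs⊆ys with ∈-∃++ (xs⊆ys (here refl))
... | us , vs , refl = begin
  suc (length xs)              ≤⟨ s≤s (unique⊆⇒length≤ uxs xs⊆us++vs) ⟩
  suc (length (us ++ vs))      ≡⟨ cong suc (length-++ us) ⟩
  suc (length us + length vs)  ≡⟨ +-suc (length us) (length vs) ⟨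
  length us + suc (length vs)  ≡⟨ length-++ us ⟨
  length (us ++ x ∷ vs)        ∎
  where
  open ≤-Reasoning
  xs⊆us++vs : ∀ {y} → y ∈ xs → y ∈ us ++ vs
  xs⊆us++vs {y} y∈xs with ∈-++⁻ us (xs⊆ys (there y∈xs))
  ... | inj₁ y∈us         = ∈-++⁺ˡ y∈us
  ... | inj₂ (here y≡x)   = ⊥-elim (All.lookup x∉xs y∈xs (sym y≡x))
  ... | inj₂ (there y∈vs) = ∈-++⁺ʳ us y∈vs

prime⇒≥2 : ∀ {p} → Prime p → 2 ≤ p
prime⇒≥2 {p} pr = nonTrivial⇒n>1 p {{prime⇒nonTrivial pr}}

primeFactor : ∀ n → 2 ≤ n → ∃[ p ] (Prime p × p ∣ n)
primeFactor (suc zero) (s≤s ())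
primeFactor n@(suc (suc _)) _ with factorise n
... | record { factors = [] ; isFactorisation = () }
... | record { factors = p ∷ ps ; isFactorisation = n≡∏ ; factorsPrime = pr ∷ _ } =
  p , pr , subst (p ∣_) (sym n≡∏) (m∣m*n (product ps))

subProducts : List ℕ → List ℕ
subProducts []      = [ 1 ]
subProducts (p ∷ L) = subProducts L ++ map (p *_) (subProducts L)

length-subProducts : ∀ L → length (subProducts L) ≡ 2 ^ length L
length-subProducts [] = refl
length-subProducts (p ∷ L) = begin
  length (subProducts L ++ map (p *_) (subProducts L))
    ≡⟨ length-++ (subProducts L) ⟩
  length (subProducts L) + length (map (p *_) (subProducts L))
    ≡⟨ cong (length (subProducts L) +_) (length-map (p *_) (subProducts L)) ⟩
  length (subProducts L) + length (subProducts L)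
    ≡⟨ cong (λ n → n + n) (length-subProducts L) ⟩
  2 ^ length L + 2 ^ length L
    ≡⟨ cong (2 ^ length L +_) (+-identityʳ _) ⟨
  2 ^ suc (length L) ∎
  where open ≡-Reasoning

squareFree∈subProducts : ∀ L d → All Prime L → 1 ≤ d → SquareFree d →
                         (∀ p → Prime p → p ∣ d → p ∈ L) → d ∈ subProducts L
squareFree∈subProducts [] (suc zero) _ _ _ _ = here refl
squareFree∈subProducts [] d@(suc (suc _)) _ _ _ primes∈[] with primeFactor d (s≤s (s≤s z≤n))
... | p , pr , p∣d with primes∈[] p pr p∣d
... | ()
squareFree∈subProducts (p ∷ L) d (pr ∷ prL) d≥1 sf primes∈ with p ∣? d
... | no p∤d = ∈-++⁺ˡ (squareFree∈subProducts L d prL d≥1 sf primes∈L)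
  where
  primes∈L : ∀ r → Prime r → r ∣ d → r ∈ L
  primes∈L r pr r∣d with primes∈ r pr r∣d
  ... | here refl = ⊥-elim (p∤d r∣d)
  ... | there r∈L = r∈L
... | yes (divides e refl) =
  ∈-++⁺ʳ (subProducts L) (subst (_∈ map (p *_) (subProducts L)) (*-comm p e) (∈-map⁺ (p *_) e∈))
  where
  e∣d : e ∣ e * p
  e∣d = m∣m*n p
  p∤e : ¬ (p ∣ e)
  p∤e (divides f refl) = sf p pr (divides f (*-assoc f p p))
  e≥1 : 1 ≤ e
  e≥1 = >-nonZero⁻¹ e {{m*n≢0⇒m≢0 e {{>-nonZero d≥1}}}}
  primes∈L : ∀ r → Prime r → r ∣ e → r ∈ L
  primes∈L r pr r∣e with primes∈ r pr (∣-trans r∣e e∣d)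
  ... | here refl = ⊥-elim (p∤e r∣e)
  ... | there r∈L = r∈L
  e∈ : e ∈ subProducts L
  e∈ = squareFree∈subProducts L e prL e≥1 (λ r pr rr∣e → sf r pr (∣-trans rr∣e e∣d)) primes∈L

W≤2^length : ∀ m L → All Prime L → 1 ≤ m → (∀ p → Prime p → p ∣ m → p ∈ L) →
             W m ≤ 2 ^ length L
W≤2^length m L prL m≥1 primes∈ =
  subst (W m ≤_) (length-subProducts L) (unique⊆⇒length≤ unique divisors⊆)
  where
  P? = λ d → (d ∣? m) ×-dec squareFree? d
  unique : Unique (filter P? (map suc (upTo m)))
  unique = Unique.filter⁺ P? (Unique.map⁺ suc-injective (Unique.upTo⁺ m))
  divisors⊆ : ∀ {d} → d ∈ filter P? (map suc (upTo m)) → d ∈ subProducts L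
  divisors⊆ d∈ with ∈-filter⁻ P? {xs = map suc (upTo m)} d∈
  ... | d∈′ , d∣m , sf with ∈-map⁻ suc {xs = upTo m} d∈′
  ... | i , _ , refl = squareFree∈subProducts L (suc i) prL (s≤s z≤n) sf
                         (λ p pr p∣d → primes∈ p pr (∣-trans p∣d d∣m))

product∣ : ∀ L m → Unique L → All Prime L → All (_∣ m) L → product L ∣ m
product∣ [] m _ _ _ = 1∣ m
product∣ (p ∷ L) m (p∉L ∷ uL) (pr ∷ prL) (p∣m ∷ L∣m) with product∣ L m uL prL L∣m
... | divides k m≡k*∏L with euclidsLemma k (product L) pr (subst (p ∣_) m≡k*∏L p∣m)
... | inj₂ p∣∏L = ⊥-elim (All.lookup p∉L (factorisationHasAllPrimeFactors pr p∣∏L prL) refl)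
... | inj₁ (divides j refl) = divides j (trans m≡k*∏L (*-assoc j p (product L)))

2^length≤product : ∀ L → All (2 ≤_) L → 2 ^ length L ≤ product L
2^length≤product [] _ = ≤-refl
2^length≤product (x ∷ L) (x≥2 ∷ L≥2) = *-mono-≤ x≥2 (2^length≤product L L≥2)

primeDivisors : ℕ → List ℕ
primeDivisors m = filter (λ p → prime? p ×-dec p ∣? m) (upTo (suc m))

primeDivisors-unique : ∀ m → Unique (primeDivisors m)
primeDivisors-unique m = Unique.filter⁺ (λ p → prime? p ×-dec p ∣? m) (Unique.upTo⁺ (suc m))

∈primeDivisors⁻ : ∀ m {p} → p ∈ primeDivisors m → Prime p × p ∣ m
∈primeDivisors⁻ m p∈ = proj₂ (∈-filter⁻ (λ p → prime? p ×-dec p ∣? m) {xs = upTo (suc m)} p∈)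

∈primeDivisors⁺ : ∀ {m p} .{{_ : NonZero m}} → Prime p → p ∣ m → p ∈ primeDivisors m
∈primeDivisors⁺ {m} pr p∣m =
  ∈-filter⁺ (λ p → prime? p ×-dec p ∣? m) (∈-upTo⁺ (s≤s (∣⇒≤ p∣m))) (pr , p∣m)

prime∤! : ∀ {p} → Prime p → ∀ m → m < p → ¬ p ∣ m !
prime∤! pr zero _ p∣1 = nonTrivial⇒≢1 {{prime⇒nonTrivial pr}} (∣1⇒≡1 p∣1)
prime∤! pr (suc m) m+1<p p∣ with euclidsLemma (suc m) (m !) pr p∣
... | inj₁ p∣m+1 = <⇒≱ m+1<p (∣⇒≤ p∣m+1)
... | inj₂ p∣m!  = prime∤! pr m (<-trans (n<1+n m) m+1<p) p∣m!

C*factorials≡! : ∀ {n k} → k ≤ n → (n C k) * (k ! * (n ∸ k) !) ≡ n !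
C*factorials≡! {n} {k} k≤n = begin
  (n C k) * (k ! * (n ∸ k) !)                       ≡⟨ cong (_* (k ! * (n ∸ k) !)) (nCk≡n!/k![n-k]! k≤n) ⟩
  n ! / (k ! * (n ∸ k) !) * (k ! * (n ∸ k) !)     ≡⟨ m/n*n≡m (k![n∸k]!∣n! k≤n) ⟩
  n !                                             ∎
  where
  open ≡-Reasoning
  instance _ = k !* (n ∸ k) !≢0

0^n≡0 : ∀ n .{{_ : NonZero n}} → 0 ^ n ≡ 0
0^n≡0 (suc n) = refl

n∣n! : ∀ n .{{_ : NonZero n}} → n ∣ n !
n∣n! (suc n) = m∣m*n (n !)

-- A prime p divides the binomial coefficients p C k with 0 < k < p:
-- p divides p ! = (p C k) * k ! * (p - k) ! but neither factorial.
prime∣C : ∀ {p k} → Prime p → 0 < k → k < p → p ∣ p C k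
prime∣C {p} {k} pr 0<k k<p
  with euclidsLemma (p C k) (k ! * (p ∸ k) !) pr
         (subst (p ∣_) (sym (C*factorials≡! (<⇒≤ k<p))) (n∣n! p {{prime⇒nonZero pr}}))
... | inj₁ p∣C = p∣C
... | inj₂ p∣k![p-k]! with euclidsLemma (k !) ((p ∸ k) !) pr p∣k![p-k]!
...   | inj₁ p∣k!     = ⊥-elim (prime∤! pr k k<p p∣k!)
...   | inj₂ p∣[p-k]! = ⊥-elim (prime∤! pr (p ∸ k) (∸-monoʳ-< 0<k (<⇒≤ k<p)) p∣[p-k]!)

binomialSum : ℕ → ℕ → ℕ → ℕ
binomialSum a n zero    = 0
binomialSum a n (suc m) = binomialSum a n m + (n C m) * a ^ m

-- Pascal's rule, summed over i < m + 1.
binomialSum-pascal : ∀ a n m →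
  binomialSum a (suc n) (suc m) ≡ binomialSum a n (suc m) + a * binomialSum a n m
binomialSum-pascal a n zero = sym (cong (1 +_) (*-zeroʳ a))
binomialSum-pascal a n (suc m) = begin
  binomialSum a (suc n) (suc m) + (suc n C suc m) * a ^ suc m
    ≡⟨ cong₂ (λ s c → s + c * a ^ suc m) (binomialSum-pascal a n m) (sym (nCk+nC[k+1]≡[n+1]C[k+1] n m)) ⟩
  (binomialSum a n (suc m) + a * binomialSum a n m) + ((n C m) + (n C suc m)) * (a * a ^ m)
    ≡⟨ regroup (binomialSum a n (suc m)) (binomialSum a n m) a (n C m) (n C suc m) (a ^ m) ⟩
  (binomialSum a n (suc m) + (n C suc m) * (a * a ^ m)) + a * (binomialSum a n m + (n C m) * a ^ m) ∎
  where
  open ≡-Reasoning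
  regroup : ∀ (S S′ a c c′ x : ℕ) → (S + a * S′) + (c + c′) * (a * x) ≡ (S + c′ * (a * x)) + a * (S′ + c * x)
  regroup = solve-∀

binomialTheorem : ∀ a n → suc a ^ n ≡ binomialSum a n (suc n)
binomialTheorem a zero = refl
binomialTheorem a (suc n) = begin
  suc a * suc a ^ n                                 ≡⟨ cong (suc a *_) (binomialTheorem a n) ⟩
  suc a * S                                         ≡⟨⟩
  S + a * S                                         ≡⟨ cong (_+ a * S) topTermVanishes ⟨
  binomialSum a n (suc (suc n)) + a * S             ≡⟨ binomialSum-pascal a n (suc n) ⟨
  binomialSum a (suc n) (suc (suc n))               ∎
  where
  open ≡-Reasoning
  S = binomialSum a n (suc n)
  topTermVanishes : binomialSum a n (suc (suc n)) ≡ S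
  topTermVanishes = begin
    S + (n C suc n) * a ^ suc n    ≡⟨ cong (λ c → S + c * a ^ suc n) (k>n⇒nCk≡0 (n<1+n n)) ⟩
    S + 0                          ≡⟨ +-identityʳ S ⟩
    S                              ∎

-- Fermat's little theorem for a prime p, via the binomial theorem.
module Fermat {p} (pr : Prime p) where

  instance _ = prime⇒nonZero pr

  -- All but the constant and the top term of (1 + a) ^ p are multiples of p.
  binomialSum≡1[p] : ∀ a m → 1 ≤ m → m ≤ p → ∃[ c ] binomialSum a p m ≡ 1 + c * p
  binomialSum≡1[p] a (suc zero) _ _ = 0 , refl
  binomialSum≡1[p] a (suc (suc m)) _ m+2≤p
    with binomialSum≡1[p] a (suc m) (s≤s z≤n) (<⇒≤ m+2≤p) | prime∣C pr (s≤s z≤n) m+2≤p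
  ... | c , eq | divides d C≡d*p = c + d * a ^ suc m , (begin
    binomialSum a p (suc m) + (p C suc m) * a ^ suc m    ≡⟨ cong₂ (λ s c → s + c * a ^ suc m) eq C≡d*p ⟩
    1 + c * p + d * p * a ^ suc m                        ≡⟨ collect c d (a ^ suc m) p ⟩
    1 + (c + d * a ^ suc m) * p                          ∎)
    where
    open ≡-Reasoning
    collect : ∀ (c d x p : ℕ) → 1 + c * p + d * p * x ≡ 1 + (c + d * x) * p
    collect = solve-∀

  freshmansDream : ∀ a → ∃[ c ] suc a ^ p ≡ 1 + c * p + a ^ p
  freshmansDream a with binomialSum≡1[p] a p (>-nonZero⁻¹ p) ≤-refl
  ... | c , eq = c , (begin
    suc a ^ p                             ≡⟨ binomialTheorem a p ⟩
    binomialSum a p p + (p C p) * a ^ p   ≡⟨ cong₂ (λ s c → s + c * a ^ p) eq (nCn≡1 p) ⟩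
    1 + c * p + 1 * a ^ p                 ≡⟨ cong (1 + c * p +_) (*-identityˡ (a ^ p)) ⟩
    1 + c * p + a ^ p                     ∎)
    where open ≡-Reasoning

  fermat : ∀ a → ∃[ c ] a ^ p ≡ a + c * p
  fermat zero = 0 , 0^n≡0 p
  fermat (suc a) with freshmansDream a | fermat a
  ... | c , eq₁ | d , eq₂ = c + d , (begin
    suc a ^ p                 ≡⟨ eq₁ ⟩
    1 + c * p + a ^ p         ≡⟨ cong (1 + c * p +_) eq₂ ⟩
    1 + c * p + (a + d * p)   ≡⟨ collect a c d p ⟩
    suc a + (c + d) * p       ∎)
    where
    open ≡-Reasoning
    collect : ∀ (a c d p : ℕ) → 1 + c * p + (a + d * p) ≡ suc a + (c + d) * p
    collect = solve-∀

  fermat-unit : ∀ x → ¬ p ∣ x → ∃[ d ] x ^ (p ∸ 1) ≡ 1 + d * p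
  fermat-unit x p∤x with fermat x
  ... | c , x^p≡x+cp with euclidsLemma x (x ^ (p ∸ 1) ∸ 1) pr (divides c x*[x^[p-1]-1]≡cp)
    where
    x*[x^[p-1]-1]≡cp : x * (x ^ (p ∸ 1) ∸ 1) ≡ c * p
    x*[x^[p-1]-1]≡cp = begin
      x * (x ^ (p ∸ 1) ∸ 1)      ≡⟨ *-distribˡ-∸ x (x ^ (p ∸ 1)) 1 ⟩
      x * x ^ (p ∸ 1) ∸ x * 1    ≡⟨ cong₂ _∸_ (cong (x ^_) (suc-pred p)) (*-identityʳ x) ⟩
      x ^ p ∸ x                  ≡⟨ cong (_∸ x) x^p≡x+cp ⟩
      x + c * p ∸ x              ≡⟨ m+n∸m≡n x (c * p) ⟩
      c * p                      ∎
      where open ≡-Reasoning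
  ... | inj₁ p∣x = ⊥-elim (p∤x p∣x)
  ... | inj₂ (divides d x^[p-1]-1≡dp) = d , (begin
    x ^ (p ∸ 1)              ≡⟨ m+[n∸m]≡n x^[p-1]≥1 ⟨
    1 + (x ^ (p ∸ 1) ∸ 1)    ≡⟨ cong (1 +_) x^[p-1]-1≡dp ⟩
    1 + d * p                ∎)
    where
    open ≡-Reasoning
    x^[p-1]≥1 : 1 ≤ x ^ (p ∸ 1)
    x^[p-1]≥1 = m^n>0 x {{≢-nonZero (λ { refl → p∤x (p ∣0) })}} (p ∸ 1)

evenOrOdd : ∀ n → ∃[ k ] (n ≡ 2 * k ⊎ n ≡ 1 + 2 * k)
evenOrOdd zero = 0 , inj₁ refl
evenOrOdd (suc n) with evenOrOdd n
... | k , inj₁ refl = k , inj₂ refl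
... | k , inj₂ refl = suc k , inj₁ (cong suc (sym (+-suc k (k + 0))))

module Congruence (m : ℕ) .{{_ : NonZero m}} where

  infix 4 _≈_
  _≈_ : ℕ → ℕ → Set
  a ≈ b = a % m ≡ b % m

  *-cong : ∀ {a b c d} → a ≈ b → c ≈ d → a * c ≈ b * d
  *-cong {a} {b} {c} {d} a≈b c≈d = begin
    (a * c) % m                ≡⟨ %-distribˡ-* a c m ⟩
    ((a % m) * (c % m)) % m    ≡⟨ cong₂ (λ u v → (u * v) % m) a≈b c≈d ⟩
    ((b % m) * (d % m)) % m    ≡⟨ %-distribˡ-* b d m ⟨
    (b * d) % m                ∎
    where open ≡-Reasoning

  ^-cong : ∀ {a b} k → a ≈ b → a ^ k ≈ b ^ k
  ^-cong zero    _   = refl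
  ^-cong (suc k) a≈b = *-cong a≈b (^-cong k a≈b)

  1+km≈1 : ∀ k → 1 + k * m ≈ 1
  1+km≈1 k = [m+kn]%n≡m%n 1 k m

  ≈⇒≡ : ∀ {a b} → a < m → b < m → a ≈ b → a ≡ b
  ≈⇒≡ a<m b<m a≈b = trans (sym (m<n⇒m%n≡m a<m)) (trans a≈b (m<n⇒m%n≡m b<m))

-- An odd prime p = n + 1 dividing x ^ (2 ^ s) + 1: then x has multiplicative
-- order 2 ^ (s + 1) modulo p, so 2 ^ (s + 1) divides p - 1 = n.
module OddPrimeDivisor {n} (pr : Prime (suc n)) (p≢2 : suc n ≢ 2)
                       (x s : ℕ) (p∣y+1 : suc n ∣ x ^ (2 ^ s) + 1) where

  private
    p = suc n
    y = x ^ (2 ^ s)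
    instance _ = prime⇒nonZero pr

  open Congruence p

  n≥2 : 2 ≤ n
  n≥2 = s≤s⁻¹ (≤∧≢⇒< (prime⇒≥2 pr) (λ 2≡p → p≢2 (sym 2≡p)))

  -- p ∤ x, for otherwise p would divide both y and y + 1.
  p∤x : ¬ p ∣ x
  p∤x p∣x = nonTrivial⇒≢1 {{prime⇒nonTrivial pr}} (∣1⇒≡1 (∣m+n∣m⇒∣n p∣y+1 (∣-trans p∣x x∣y)))
    where
    x∣y : x ∣ y
    x∣y = subst (x ∣_) (cong (x ^_) (suc-pred (2 ^ s) {{m^n≢0 2 s}})) (m∣m*n (x ^ pred (2 ^ s)))

  x^n≈1 : x ^ n ≈ 1
  x^n≈1 with Fermat.fermat-unit pr x p∤x
  ... | d , x^n≡1+dp = trans (cong (_% p) x^n≡1+dp) (1+km≈1 d)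

  y≈n : y ≈ n
  y≈n = trans (%-pred-≡0 (trans (cong (_% p) (+-comm 1 y)) (n∣m⇒m%n≡0 _ p p∣y+1)))
              (sym (m<n⇒m%n≡m (n<1+n n)))

  -- n ^ 2 = 1 + (n - 1) * p ≡ 1, hence every odd power of y is ≡ n.
  n²≈1 : n ^ 2 ≈ 1
  n²≈1 = trans (cong (_% p) (n²≡1+[n-1]p n (≤-trans (s≤s z≤n) n≥2))) (1+km≈1 (pred n))
    where
    n²≡1+[n-1]p : ∀ n → 1 ≤ n → n ^ 2 ≡ 1 + pred n * suc n
    n²≡1+[n-1]p (suc m) _ = square m
      where
      square : ∀ m → suc m * (suc m * 1) ≡ 1 + m * suc (suc m)
      square = solve-∀

  y^odd≈n : ∀ v → y ^ (1 + 2 * v) ≈ n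
  y^odd≈n v = begin
    (y * y ^ (2 * v)) % p        ≡⟨ cong (λ u → (y * u) % p) (^-*-assoc y 2 v) ⟨
    (y * (y ^ 2) ^ v) % p        ≡⟨ *-cong {y} {n} y≈n (^-cong {y ^ 2} {1} v (trans (^-cong {y} {n} 2 y≈n) n²≈1)) ⟩
    (n * 1 ^ v) % p              ≡⟨ cong (λ u → (n * u) % p) (^-zeroˡ v) ⟩
    (n * 1) % p                  ≡⟨ cong (_% p) (*-identityʳ n) ⟩
    n % p                        ∎
    where open ≡-Reasoning

  -- If 2 ^ j ∣ n with j ≤ s, the cofactor is even: were n = 2 ^ j * u
  -- with u odd, then x ^ (n * 2 ^ (s - j)) would be both ≡ 1 and ≡ y ^ u ≡ n.
  2^j∣n⇒2^[j+1]∣n : ∀ j → j ≤ s → 2 ^ j ∣ n → 2 ^ suc j ∣ n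
  2^j∣n⇒2^[j+1]∣n j j≤s (divides w n≡w*2^j) with evenOrOdd w
  ... | v , inj₁ refl = divides v (trans n≡w*2^j (regroup v (2 ^ j)))
    where
    regroup : ∀ (v a : ℕ) → 2 * v * a ≡ v * (2 * a)
    regroup = solve-∀
  ... | v , inj₂ refl = ⊥-elim (<⇒≢ n≥2 (sym (≈⇒≡ (n<1+n n) (s≤s (≤-trans (s≤s z≤n) n≥2)) n≈1)))
    where
    open ≡-Reasoning
    e = s ∸ j
    n*2^e≡2^s*u : n * 2 ^ e ≡ 2 ^ s * (1 + 2 * v)
    n*2^e≡2^s*u = begin
      n * 2 ^ e                          ≡⟨ cong (_* 2 ^ e) n≡w*2^j ⟩
      (1 + 2 * v) * 2 ^ j * 2 ^ e        ≡⟨ *-assoc (1 + 2 * v) (2 ^ j) (2 ^ e) ⟩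
      (1 + 2 * v) * (2 ^ j * 2 ^ e)      ≡⟨ cong ((1 + 2 * v) *_) (^-distribˡ-+-* 2 j e) ⟨
      (1 + 2 * v) * 2 ^ (j + e)          ≡⟨ cong (λ k → (1 + 2 * v) * 2 ^ k) (m+[n∸m]≡n j≤s) ⟩
      (1 + 2 * v) * 2 ^ s                ≡⟨ *-comm (1 + 2 * v) (2 ^ s) ⟩
      2 ^ s * (1 + 2 * v)                ∎
    n≈1 : n ≈ 1
    n≈1 = begin
      n % p                              ≡⟨ y^odd≈n v ⟨
      (y ^ (1 + 2 * v)) % p              ≡⟨ cong (_% p) (^-*-assoc x (2 ^ s) (1 + 2 * v)) ⟩
      (x ^ (2 ^ s * (1 + 2 * v))) % p    ≡⟨ cong (λ k → (x ^ k) % p) n*2^e≡2^s*u ⟨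
      (x ^ (n * 2 ^ e)) % p              ≡⟨ cong (_% p) (^-*-assoc x n (2 ^ e)) ⟨
      ((x ^ n) ^ (2 ^ e)) % p            ≡⟨ ^-cong {x ^ n} {1} (2 ^ e) x^n≈1 ⟩
      (1 ^ (2 ^ e)) % p                  ≡⟨ cong (_% p) (^-zeroˡ (2 ^ e)) ⟩
      1 % p                              ∎

  2^j∣n : ∀ j → j ≤ suc s → 2 ^ j ∣ n
  2^j∣n zero    _       = 1∣ n
  2^j∣n (suc j) j+1≤s+1 = 2^j∣n⇒2^[j+1]∣n j (s≤s⁻¹ j+1≤s+1) (2^j∣n j (m≤n⇒m≤1+n (s≤s⁻¹ j+1≤s+1)))

  2^[s+1]∣p-1 : 2 ^ suc s ∣ n
  2^[s+1]∣p-1 = 2^j∣n (suc s) ≤-refl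

≡1[T]⇒≥2T : ∀ T q → 2 ≤ q → T ∣ q ∸ 1 → q ≢ suc T → 2 * T ≤ q
≡1[T]⇒≥2T T (suc q) (s≤s 1≤q) (divides zero q≡0) _ = ⊥-elim (<⇒≢ 1≤q (sym q≡0))
≡1[T]⇒≥2T T (suc q) _ (divides (suc zero) q≡T+0) q≢T+1 = ⊥-elim (q≢T+1 (cong suc (trans q≡T+0 (+-identityʳ T))))
≡1[T]⇒≥2T T (suc q) _ (divides (suc (suc c)) q≡[c+2]T) _ = begin
  2 * T            ≤⟨ m≤m+n (2 * T) (c * T) ⟩
  2 * T + c * T    ≡⟨ regroup c T ⟩
  suc (suc c) * T  ≡⟨ q≡[c+2]T ⟨
  q                ≤⟨ n≤1+n q ⟩
  suc q            ∎
  where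
  open ≤-Reasoning
  regroup : ∀ (c T : ℕ) → 2 * T + c * T ≡ suc (suc c) * T
  regroup = solve-∀

-- Distinct primes that are ≡ 1 (mod T): all except possibly T + 1 are at
-- least 2T, so (2T) ^ (their number) < 2 * (their product), and even
-- ≤ (their product) when T + 1 is not among them.
[2T]^length<2*product : ∀ T P → Unique P → All (λ q → Prime q × T ∣ q ∸ 1) P →
  ((2 * T) ^ length P < 2 * product P) × (suc T ∉ P → (2 * T) ^ length P ≤ product P)
[2T]^length<2*product T [] _ _ = s≤s (s≤s z≤n) , λ _ → ≤-refl
[2T]^length<2*product T (q ∷ P) (q∉P ∷ uP) ((pr , T∣q-1) ∷ P≡1) with [2T]^length<2*product T P uP P≡1 | q ≟ suc T
... | _ , ≤∏P | yes refl = bound< , λ T+1∉ → ⊥-elim (T+1∉ (here refl))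
  where
  open ≤-Reasoning
  instance _ = productOfPrimes≢0 (All.map proj₁ P≡1)
  bound< : 2 * T * (2 * T) ^ length P < 2 * (suc T * product P)
  bound< = begin-strict
    2 * T * (2 * T) ^ length P   ≤⟨ *-monoʳ-≤ (2 * T) (≤∏P (λ T+1∈P → All.lookup q∉P T+1∈P refl)) ⟩
    2 * T * product P            <⟨ *-monoˡ-< (product P) (*-monoʳ-< 2 (n<1+n T)) ⟩
    2 * suc T * product P        ≡⟨ *-assoc 2 (suc T) (product P) ⟩
    2 * (suc T * product P)      ∎
... | <2∏P , ≤∏P | no q≢T+1 = bound< , bound≤
  where
  open ≤-Reasoning
  instance _ = prime⇒nonZero pr
  2T≤q : 2 * T ≤ q
  2T≤q = ≡1[T]⇒≥2T T q (prime⇒≥2 pr) T∣q-1 q≢T+1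
  bound< : 2 * T * (2 * T) ^ length P < 2 * (q * product P)
  bound< = begin-strict
    2 * T * (2 * T) ^ length P   ≤⟨ *-monoˡ-≤ ((2 * T) ^ length P) 2T≤q ⟩
    q * (2 * T) ^ length P       <⟨ *-monoʳ-< q <2∏P ⟩
    q * (2 * product P)          ≡⟨ x∙yz≈y∙xz *-commutativeSemigroup q 2 (product P) ⟩
    2 * (q * product P)          ∎
  bound≤ : suc T ∉ q ∷ P → 2 * T * (2 * T) ^ length P ≤ q * product P
  bound≤ T+1∉ = *-mono-≤ 2T≤q (≤∏P (λ T+1∈P → T+1∉ (there T+1∈P)))

-- Comparison of powers of two fixed bases x and y: a ⊴ b means
-- x ^ a ≤ y ^ b, i.e. a * log x ≤ b * log y.
module PowerComparison (x y : ℕ) .{{_ : NonZero y}} where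

  infix 4 _⊴_
  record _⊴_ (a b : ℕ) : Set where
    constructor mk⊴
    field x^a≤y^b : x ^ a ≤ y ^ b

  ⊴-cong : ∀ {a a′ b b′} → a ≡ a′ → b ≡ b′ → a ⊴ b → a′ ⊴ b′
  ⊴-cong refl refl a⊴b = a⊴b

  ⊴-+ : ∀ {a b c d} → a ⊴ b → c ⊴ d → a + c ⊴ b + d
  ⊴-+ {a} {b} {c} {d} (mk⊴ a⊴b) (mk⊴ c⊴d) = mk⊴ (begin
    x ^ (a + c)      ≡⟨ ^-distribˡ-+-* x a c ⟩
    x ^ a * x ^ c    ≤⟨ *-mono-≤ a⊴b c⊴d ⟩
    y ^ b * y ^ d    ≡⟨ ^-distribˡ-+-* y b d ⟨
    y ^ (b + d)      ∎)
    where open ≤-Reasoning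

  ⊴-* : ∀ {a b} c → a ⊴ b → a * c ⊴ b * c
  ⊴-* {a} {b} c (mk⊴ a⊴b) = mk⊴ (begin
    x ^ (a * c)      ≡⟨ ^-*-assoc x a c ⟨
    (x ^ a) ^ c      ≤⟨ ^-monoˡ-≤ c a⊴b ⟩
    (y ^ b) ^ c      ≡⟨ ^-*-assoc y b c ⟩
    y ^ (b * c)      ∎)
    where open ≤-Reasoning

  ⊴-root : ∀ {a b e} c .{{_ : NonZero c}} → a * c ⊴ e → e ≤ b * c → a ⊴ b
  ⊴-root {a} {b} {e} c (mk⊴ ac⊴e) e≤bc with x ^ a ≤? y ^ b
  ... | yes a⊴b = mk⊴ a⊴b
  ... | no  a⋬b = ⊥-elim (<⇒≱ (^-monoˡ-< c (≰⇒> a⋬b)) (begin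
    (x ^ a) ^ c      ≡⟨ ^-*-assoc x a c ⟩
    x ^ (a * c)      ≤⟨ ac⊴e ⟩
    y ^ e            ≤⟨ ^-monoʳ-≤ y e≤bc ⟩
    y ^ (b * c)      ≡⟨ ^-*-assoc y b c ⟨
    (y ^ b) ^ c      ∎))
    where open ≤-Reasoning

-- A sequence S₀ ≤ S₁ ≤ … of exponents of 2, measured against powers of q:
-- if S₀ ≤ 2 log₂ q and each increment nₖ = S_{k+1} - S_k satisfies
-- (k + 3) nₖ ≤ 2^{k+1} log₂ q, then (k + 1) S_{k+1} ≤ 2^{k+2} log₂ q.
-- Up to k = 2 this follows by summing the increments exactly
-- (S₁ ≤ 8/3, S₂ ≤ 11/3, S₃ ≤ 79/15 in units of log₂ q); from then on the
-- bound propagates, since 1/k + 1/(k+3) ≤ 2/(k+1) for k ≥ 3.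
module Recurrence (q : ℕ) .{{_ : NonZero q}} (S n : ℕ → ℕ)
                  (S-suc : ∀ k → S (suc k) ≡ S k + n k)
                  (S₀-bound : PowerComparison._⊴_ 2 q (S 0) 2)
                  (n-bound : ∀ k → PowerComparison._⊴_ 2 q (n k * (3 + k)) (2 ^ suc k)) where

  open PowerComparison 2 q

  accumulate : ∀ k {c d e f} → S k * d ⊴ c → n k * e ⊴ f → S (suc k) * (d * e) ⊴ c * e + f * d
  accumulate k {c} {d} {e} {f} Sd⊴c ne⊴f =
    ⊴-cong (sym (trans (cong (_* (d * e)) (S-suc k)) (regroup (S k) (n k) d e))) refl
           (⊴-+ (⊴-* e Sd⊴c) (⊴-* d ne⊴f))
    where
    regroup : ∀ (s m d e : ℕ) → (s + m) * (d * e) ≡ s * d * e + m * e * d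
    regroup = solve-∀

  S₁-bound : S 1 * 3 ⊴ 8
  S₁-bound = accumulate 0 (⊴-cong (sym (*-identityʳ (S 0))) refl S₀-bound) (n-bound 0)

  S₂-bound : S 2 * 12 ⊴ 44
  S₂-bound = accumulate 1 S₁-bound (n-bound 1)

  S₃-bound : S 3 * 60 ⊴ 316
  S₃-bound = accumulate 2 S₂-bound (n-bound 2)

  -- (2k + 3)(k + 1) ≤ 2k(k + 3) for k = j + 3.
  propagation : ∀ j → (2 * j + 9) * (j + 4) ≤ (j + 6) * (2 * (j + 3))
  propagation j = subst₂ _≤_ (lhs j) (rhs j) (m≤m+n _ j)
    where
    lhs : ∀ (j : ℕ) → 2 * j * j + 17 * j + 36 ≡ (2 * j + 9) * (j + 4)
    lhs = solve-∀
    rhs : ∀ (j : ℕ) → 2 * j * j + 17 * j + 36 + j ≡ (j + 6) * (2 * (j + 3))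
    rhs = solve-∀

  -- The claimed bound: the cases k ≤ 2 by rounding the exact sums, the
  -- case k + 1 ≥ 4 from the case k and the k-th increment.
  bound : ∀ k → S (suc k) * suc k ⊴ 2 ^ (2 + k)
  bound 0 = ⊴-root 3  (⊴-cong (sym (*-assoc (S 1) 1 3)) refl S₁-bound) (m≤m+n 8 4)
  bound 1 = ⊴-root 6  (⊴-cong (sym (*-assoc (S 2) 2 6)) refl S₂-bound) (m≤m+n 44 4)
  bound 2 = ⊴-root 20 (⊴-cong (sym (*-assoc (S 3) 3 20)) refl S₃-bound) (m≤m+n 316 4)
  bound (suc (suc (suc j))) = ⊴-root (k * (3 + k)) {{m*n≢0 k (3 + k)}}
      (⊴-cong (regroup (S (suc k)) k) refl (⊴-* (suc k) (accumulate k (bound (suc (suc j))) (n-bound k))))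
      (subst₂ _≤_ (expand-lhs P j) (expand-rhs P j) (*-monoʳ-≤ P (propagation j)))
    where
    k = 3 + j
    P = 2 ^ suc k
    regroup : ∀ (s k : ℕ) → s * (k * (3 + k)) * suc k ≡ s * suc k * (k * (3 + k))
    regroup = solve-∀
    expand-lhs : ∀ (P j : ℕ) → P * ((2 * j + 9) * (j + 4)) ≡ (P * (3 + (3 + j)) + P * (3 + j)) * suc (3 + j)
    expand-lhs = solve-∀
    expand-rhs : ∀ (P j : ℕ) → P * ((j + 6) * (2 * (j + 3))) ≡ 2 * P * ((3 + j) * (3 + (3 + j)))
    expand-rhs = solve-∀

odd^ : ∀ r m → ∃[ c ] (1 + 2 * r) ^ m ≡ 1 + 2 * c
odd^ r zero = 0 , refl
odd^ r (suc m) with odd^ r m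
... | c , eq = r + c + 2 * r * c , trans (cong ((1 + 2 * r) *_) eq) (expand r c)
  where
  expand : ∀ (r c : ℕ) → (1 + 2 * r) * (1 + 2 * c) ≡ 1 + 2 * (r + c + 2 * r * c)
  expand = solve-∀

-- The setting of the theorem: an odd q = 1 + 2r ≥ 3 and the numbers
-- Z k = q ^ 2^(k+1), N k = Z k - 1, F k = Z k + 1, so that
-- N (k + 1) = N k * F k: the prime divisors of N (k + 1) are those of
-- N k together with the new prime divisors of F k.
module OddBase (q r : ℕ) (q≡1+2r : q ≡ 1 + 2 * r) (q≥3 : 3 ≤ q) where

  instance
    q≢0 : NonZero q
    q≢0 = >-nonZero (≤-trans (s≤s z≤n) q≥3)

  Z N F : ℕ → ℕ
  Z k = q ^ (2 ^ suc k)
  N k = Z k ∸ 1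
  F k = Z k + 1

  Z-odd : ∀ k → ∃[ c ] Z k ≡ 1 + 2 * c
  Z-odd k = subst (λ q → ∃[ c ] q ^ (2 ^ suc k) ≡ 1 + 2 * c) (sym q≡1+2r) (odd^ r (2 ^ suc k))

  N≥1 : ∀ k → 1 ≤ N k
  N≥1 k = ∸-monoˡ-≤ 1 (begin
    2                ≤⟨ ≤-trans (n≤1+n 2) q≥3 ⟩
    q                ≡⟨ *-identityʳ q ⟨
    q ^ 1            ≤⟨ ^-monoʳ-≤ q (m^n>0 2 (suc k)) ⟩
    q ^ (2 ^ suc k)  ∎)
    where open ≤-Reasoning

  -- Z (k + 1) = Z k ^ 2, so N (k + 1) = (Z k - 1)(Z k + 1).
  N-suc : ∀ k → N (suc k) ≡ N k * F k
  N-suc k = begin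
    q ^ (2 ^ suc (suc k)) ∸ 1    ≡⟨ cong (λ e → q ^ e ∸ 1) (*-comm 2 (2 ^ suc k)) ⟩
    q ^ (2 ^ suc k * 2) ∸ 1      ≡⟨ cong (_∸ 1) (^-*-assoc q (2 ^ suc k) 2) ⟨
    Z k ^ 2 ∸ 1                  ≡⟨ z²-1≡[z-1][z+1] (Z k) ⟩
    N k * F k                    ∎
    where
    open ≡-Reasoning
    z²-1≡[z-1][z+1] : ∀ z → z ^ 2 ∸ 1 ≡ (z ∸ 1) * (z + 1)
    z²-1≡[z-1][z+1] zero    = refl
    z²-1≡[z-1][z+1] (suc w) = cong (_∸ 1) (expand w)
      where
      expand : ∀ w → suc w * (suc w * 1) ≡ 1 + w * (suc w + 1)
      expand = solve-∀

  2∣N : ∀ k → 2 ∣ N k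
  2∣N k with Z-odd k
  ... | c , Z≡1+2c = divides c (trans (cong (_∸ 1) Z≡1+2c) (*-comm 2 c))

  2∣F : ∀ k → 2 ∣ F k
  2∣F k with Z-odd k
  ... | c , Z≡1+2c = divides (suc c) (trans (cong (_+ 1) Z≡1+2c) (regroup c))
    where
    regroup : ∀ c → 1 + 2 * c + 1 ≡ suc c * 2
    regroup = solve-∀

  newPrimes : ℕ → List ℕ
  newPrimes k = filter (λ p → ¬? (p ∣? N k)) (primeDivisors (F k))

  newPrimes-unique : ∀ k → Unique (newPrimes k)
  newPrimes-unique k = Unique.filter⁺ (λ p → ¬? (p ∣? N k)) (primeDivisors-unique (F k))

  ∈newPrimes⁻ : ∀ k {p} → p ∈ newPrimes k → (Prime p × p ∣ F k) × ¬ p ∣ N k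
  ∈newPrimes⁻ k p∈ with ∈-filter⁻ (λ p → ¬? (p ∣? N k)) {xs = primeDivisors (F k)} p∈
  ... | p∈′ , p∤N = ∈primeDivisors⁻ (F k) p∈′ , p∤N

  primes : ℕ → List ℕ
  primes zero    = primeDivisors (N 0)
  primes (suc k) = primes k ++ newPrimes k

  primes-prime : ∀ k → All Prime (primes k)
  primes-prime k = All.tabulate (prime k)
    where
    prime : ∀ k {p} → p ∈ primes k → Prime p
    prime zero    p∈ = proj₁ (∈primeDivisors⁻ (N 0) p∈)
    prime (suc k) p∈ with ∈-++⁻ (primes k) p∈
    ... | inj₁ p∈old = prime k p∈old
    ... | inj₂ p∈new = proj₁ (proj₁ (∈newPrimes⁻ k p∈new))

  primes-complete : ∀ k p → Prime p → p ∣ N k → p ∈ primes k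
  primes-complete zero p pr p∣N = ∈primeDivisors⁺ {{>-nonZero (N≥1 0)}} pr p∣N
  primes-complete (suc k) p pr p∣N
    with euclidsLemma (N k) (F k) pr (subst (p ∣_) (N-suc k) p∣N)
  ... | inj₁ p∣Nk = ∈-++⁺ˡ (primes-complete k p pr p∣Nk)
  ... | inj₂ p∣Fk with p ∣? N k
  ...   | yes p∣Nk = ∈-++⁺ˡ (primes-complete k p pr p∣Nk)
  ...   | no  p∤Nk = ∈-++⁺ʳ (primes k)
    (∈-filter⁺ (λ p → ¬? (p ∣? N k)) (∈primeDivisors⁺ {{>-nonZero (m≤n+m 1 (Z k))}} pr p∣Fk) p∤Nk)

  open PowerComparison 2 q

  primes₀-bound : length (primes 0) ⊴ 2
  primes₀-bound = mk⊴ (begin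
    2 ^ length (primes 0)    ≤⟨ 2^length≤product (primes 0) (All.map prime⇒≥2 (primes-prime 0)) ⟩
    product (primes 0)       ≤⟨ ∣⇒≤ {{>-nonZero (N≥1 0)}} (product∣ (primes 0) (N 0) (primeDivisors-unique (N 0))
                                  (primes-prime 0) (All.tabulate (λ p∈ → proj₂ (∈primeDivisors⁻ (N 0) p∈)))) ⟩
    N 0                      ≤⟨ m∸n≤m (Z 0) 1 ⟩
    q ^ 2                    ∎)
    where open ≤-Reasoning

  -- Every new prime of F k = q ^ 2^(k+1) + 1 is odd (2 ∣ N k), hence
  -- ≡ 1 (mod 2 ^ (k + 2)).
  newPrime≡1 : ∀ {k p} → p ∈ newPrimes k → Prime p × 2 ^ (2 + k) ∣ p ∸ 1
  newPrime≡1 {k} {zero} p∈ = ⊥-elim (≢-nonZero⁻¹ 0 {{prime⇒nonZero (proj₁ (proj₁ (∈newPrimes⁻ k p∈)))}} refl)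
  newPrime≡1 {k} {suc n} p∈ with ∈newPrimes⁻ k p∈
  ... | (pr , p∣F) , p∤N =
    pr , OddPrimeDivisor.2^[s+1]∣p-1 pr (λ p≡2 → p∤N (subst (_∣ N k) (sym p≡2) (2∣N k))) q (suc k) p∣F

  -- The new primes are distinct, odd and ≡ 1 (mod 2 ^ (k + 2)); together
  -- with 2 they divide F k, so
  -- 2 ^ ((k + 3) * #new) < 2 * (their product) ≤ F k = Z k + 1.
  newPrimes-bound : ∀ k → length (newPrimes k) * (3 + k) ⊴ 2 ^ suc k
  newPrimes-bound k = mk⊴ (m<1+n⇒m≤n (begin-strict
    2 ^ (m * (3 + k))           ≡⟨ cong (2 ^_) (*-comm m (3 + k)) ⟩
    2 ^ ((3 + k) * m)           ≡⟨ ^-*-assoc 2 (3 + k) m ⟨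
    (2 ^ (3 + k)) ^ m           <⟨ proj₁ ([2T]^length<2*product (2 ^ (2 + k)) (newPrimes k) (newPrimes-unique k)
                                     (All.tabulate (newPrime≡1 {k}))) ⟩
    2 * product (newPrimes k)   ≤⟨ ∣⇒≤ {{>-nonZero (m≤n+m 1 (Z k))}} 2*product∣F ⟩
    Z k + 1                     ≡⟨ +-comm (Z k) 1 ⟩
    suc (Z k)                   ∎))
    where
    open ≤-Reasoning
    m = length (newPrimes k)
    2∉newPrimes : All (2 ≢_) (newPrimes k)
    2∉newPrimes = All.tabulate (λ p∈ 2≡p → proj₂ (∈newPrimes⁻ k p∈) (subst (_∣ N k) 2≡p (2∣N k)))
    2*product∣F : 2 * product (newPrimes k) ∣ F k
    2*product∣F = product∣ (2 ∷ newPrimes k) (F k) (2∉newPrimes ∷ newPrimes-unique k)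
      (prime[2] ∷ All.tabulate (λ p∈ → proj₁ (proj₁ (∈newPrimes⁻ k p∈))))
      (2∣F k ∷ All.tabulate (λ p∈ → proj₂ (proj₁ (∈newPrimes⁻ k p∈))))

  W-bound : ∀ k → W (N (suc k)) ^ suc k ≤ q ^ (2 ^ (2 + k))
  W-bound k = begin
    W (N (suc k)) ^ suc k                  ≤⟨ ^-monoˡ-≤ (suc k) (W≤2^length (N (suc k)) (primes (suc k))
                                                (primes-prime (suc k)) (N≥1 (suc k)) (primes-complete (suc k))) ⟩
    (2 ^ length (primes (suc k))) ^ suc k  ≡⟨ ^-*-assoc 2 (length (primes (suc k))) (suc k) ⟩
    2 ^ (length (primes (suc k)) * suc k)  ≤⟨ _⊴_.x^a≤y^b (Recurrence.bound q (λ k → length (primes k)) (λ k → length (newPrimes k))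
                                                (λ k → length-++ (primes k)) primes₀-bound newPrimes-bound k) ⟩
    q ^ (2 ^ (2 + k))                      ∎
    where open ≤-Reasoning

mainTheorem8 : (q t : ℕ) → PrimePower q → ∃[ r ] q ≡ 2 * r + 1 → 3 ≤ q → 2 ≤ t →
    W (q ^ (2 ^ t) ∸ 1) ^ (t ∸ 1) < 2 ^ (t ∸ 1) * q ^ (2 ^ t)
mainTheorem8 q (suc zero) _ _ _ (s≤s ())
mainTheorem8 q (suc (suc k)) _ (r , q≡2r+1) q≥3 _ = begin-strict
  W (N (suc k)) ^ suc k            ≤⟨ W-bound k ⟩
  q ^ (2 ^ (2 + k))                <⟨ m<m*n (q ^ (2 ^ (2 + k))) (2 ^ suc k) {{m^n≢0 q (2 ^ (2 + k))}} (*-monoʳ-≤ 2 (m^n>0 2 k)) ⟩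
  q ^ (2 ^ (2 + k)) * 2 ^ suc k    ≡⟨ *-comm (q ^ (2 ^ (2 + k))) (2 ^ suc k) ⟩
  2 ^ suc k * q ^ (2 ^ (2 + k))    ∎
  where
  open ≤-Reasoning
  open OddBase q r (trans q≡2r+1 (+-comm (2 * r) 1)) q≥3
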